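{- Let $a<b$ be relatively prime positive integers, let $\mathbf{c}\in\mathbb{Z}^a$ with $\sum_i c_i=0$ be such that $\lambda=\mathbf{core}_a(\mathbf{c})$ is an $(a,b)$-core, and let $\mathbf{x}=\mathbf{c}+\mathbf{s}$ with $s_i=\frac{i}{a}-\frac{a-1}{2a}$. Writing $\lfloor y\rfloor_0=\max(0,\lfloor y\rfloor)$, the skew length of $\lambda$ is $$s\ell(\lambda)=\sum_{i,j=0}^{a-1}\Big(\lfloor x_i-x_j\rfloor_0-\big\lfloor x_i-x_j-\tfrac{b}{a}\big\rfloor_0\Big).$$
   Context: For $\mathbf{c}\in\mathbb{Z}^a$ with $\sum c_i=0$, $\mathbf{core}_a(\mathbf{c})$ is the unique partition $\lambda=(\lambda_1\ge\lambda_2\ge\cdots\ge0)$ with $\{\lambda_j-j+\frac12 : j\ge1\}=\bigcup_{i=0}^{a-1}\{ma-i-\frac12 : m\in\mathbb{Z},\ m\le -c_i\}$; this is a bijection onto $a$-cores. An $(a,b)$-core is a partition with no hook length (arm + leg + 1) equal to $a$ or to $b$. Row $j$ of $\lambda$ (the $j$-th part, $j\ge1$) is called an $a$-row if $\lambda_j-j$ is the largest element of $\{\lambda_i-i : i\ge1,\ \lambda_i-i\equiv\lambda_j-j \pmod a\}$. The $(a,b)$ skew length $s\ell(\lambda)$ is the number of cells of $\lambda$ that lie in an $a$-row and have hook length less than $b$. -}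

module Defs where

open import Data.Nat as ℕ using (ℕ; zero; suc; NonZero)
open import Data.Integer as ℤ using (ℤ; +_)
open import Data.Integer.Divisibility using () renaming (_∣_ to _∣ℤ_)
open import Data.Rational as ℚ using (ℚ; floor; ½)
open import Data.Fin using (Fin; toℕ)
open import Data.List using (List; []; _∷_; length; filter)
open import Data.List.Relation.Unary.All using (All)
open import Data.List.Relation.Unary.Linked using (Linked)
open import Data.List.Relation.Unary.Unique.Propositional using (Unique)
open import Data.List.Membership.Propositional using (_∈_)
open import Data.Product using (Σ; ∃; ∃-syntax; _×_; _,_)
open import Function.Bundles using (_⇔_)
open import Data.Nat.Properties using (m*n≢0)
open import Relation.Binary.PropositionalEquality using (_≡_)

sumℤ : ∀ {n} → (Fin n → ℤ) → ℤ
sumℤ {zero}  f = + 0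
sumℤ {suc n} f = f Fin.zero ℤ.+ sumℤ (λ i → f (Fin.suc i))
  where import Data.Fin as Fin

IsPartition : List ℕ → Set
IsPartition p = Linked ℕ._≥_ p × All (0 ℕ.<_) p

-- part p j = λ_j for j ≥ 1 (1-indexed); 0 when j = 0 or j > length
part : List ℕ → ℕ → ℕ
part []       _             = 0
part (x ∷ xs) zero          = 0
part (x ∷ xs) (suc zero)    = x
part (x ∷ xs) (suc (suc j)) = part xs (suc j)

conj : List ℕ → ℕ → ℕ
conj p k = length (filter (k ℕ.≤?_) p)

IsCell : List ℕ → ℕ × ℕ → Set
IsCell p (j , k) = 1 ℕ.≤ j × 1 ℕ.≤ k × k ℕ.≤ part p j

hook : List ℕ → ℕ × ℕ → ℕ
hook p (j , k) = (part p j ℕ.∸ k) ℕ.+ (conj p k ℕ.∸ j) ℕ.+ 1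

IsCore₂ : ℕ → ℕ → List ℕ → Set
IsCore₂ a b p = ∀ c → IsCell p c → (hook p c ≡ a → ⊥) × (hook p c ≡ b → ⊥)
  where open import Data.Empty using (⊥)

content : List ℕ → ℕ → ℤ
content p j = + part p j ℤ.- + j

IsARow : ℕ → List ℕ → ℕ → Set
IsARow a p j = 1 ℕ.≤ j × (∀ i → 1 ℕ.≤ i → (+ a) ∣ℤ (content p i ℤ.- content p j)
                                → content p i ℤ.≤ content p j)

SkewCell : ℕ → ℕ → List ℕ → ℕ × ℕ → Set
SkewCell a b p (j , k) = IsCell p (j , k) × IsARow a p j × hook p (j , k) ℕ.< b

-- core_a(c): the partition p with
--   { λ_j - j + 1/2 : j ≥ 1 } = ⋃_{i<a} { m a - i - 1/2 : m ∈ ℤ, m ≤ - c_i }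
-- (stated as a relation; the partition is unique)

ℤtoℚ : ℤ → ℚ
ℤtoℚ z = z ℚ./ 1

IsCoreOf : (a : ℕ) → (Fin a → ℤ) → List ℕ → Set
IsCoreOf a c p = ∀ (q : ℚ) →
  (∃[ j ] (1 ℕ.≤ j × q ≡ ℤtoℚ (content p j) ℚ.+ ½))
  ⇔ (∃[ i ] ∃[ m ] (m ℤ.≤ ℤ.- c i
        × q ≡ ℤtoℚ (m ℤ.* + a) ℚ.- ℤtoℚ (+ toℕ i) ℚ.- ½))

xvec : (a : ℕ) .{{_ : NonZero a}} → (Fin a → ℤ) → Fin a → ℚ
xvec a c i = ℤtoℚ (c i) ℚ.+ ((+ toℕ i) ℚ./ a ℚ.- (+ (a ℕ.∸ 1)) ℚ./ (2 ℕ.* a))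
  where instance
          nz2a : NonZero (2 ℕ.* a)
          nz2a = m*n≢0 2 a

floor₀ : ℚ → ℤ
floor₀ y = + 0 ℤ.⊔ floor y

skewSum : (a b : ℕ) .{{_ : NonZero a}} → (Fin a → ℤ) → ℤ
skewSum a b c = sumℤ λ i → sumℤ λ j →
  floor₀ (xvec a c i ℚ.- xvec a c j)
    ℤ.- floor₀ (xvec a c i ℚ.- xvec a c j ℚ.- (+ b) ℚ./ a)

module Submission where

-- Read a partition λ through its boundary: row j ≥ 1 gives the bead λ_j - j,
-- column k ≥ 1 gives the gap k - 1 - λ'_k.  Beads and gaps partition ℤ, the
-- cells are the pairs (j , k) with gap k < bead j, and such a cell has hook
-- length bead j - gap k.  For λ = core_a(c) the beads on runner i of the
-- a-abacus are exactly the numbers m·a - i - 1 with m ≤ -c_i.  Hence the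
-- a-rows are the rows whose bead is a top bead top_i = -c_i·a - i - 1, and the
-- gaps are the numbers top_u + t·a with t ≥ 1.  So the skew cells correspond
-- to the pairs (top_w , top_u + t·a) with top_w - b < top_u + t·a < top_w, and
-- as x_u - x_w = (top_w - top_u)/a these are exactly the t with
-- ⌊x_u - x_w - b/a⌋₀ < t ≤ ⌊x_u - x_w⌋₀.

module IntegerRearrangement where

  open import Data.Nat as ℕ using (ℕ; suc)
  open import Data.Integer as ℤ using (ℤ; +_; -[1+_]; _+_; _*_; _-_; -_; _≤_; _<_; +<+)
  import Data.Integer.Properties as ℤP
  open import Data.Integer.Tactic.RingSolver using (solve-∀)
  open import Data.Product using (∃-syntax; _,_)
  open import Relation.Binary.PropositionalEquality

  +-cancelʳ-≡ : ∀ x y k → x + k ≡ y + k → x ≡ y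
  +-cancelʳ-≡ x y k h = trans (sym (add-sub x k)) (trans (cong (_- k) h) (add-sub y k))
    where add-sub : ∀ x k → x + k - k ≡ x
          add-sub = solve-∀

  +-cancelʳ-≤ : ∀ x y k → x + k ≤ y + k → x ≤ y
  +-cancelʳ-≤ x y k h = subst₂ _≤_ (add-sub x k) (add-sub y k) (ℤP.+-monoˡ-≤ (- k) h)
    where add-sub : ∀ x k → x + k + - k ≡ x
          add-sub = solve-∀

  private
    shift-down : ∀ x y w → x + w + (- y - w) ≡ x - y
    shift-down = solve-∀
    shift-up : ∀ x y w → x - y + (y + w) ≡ x + w
    shift-up = solve-∀

  cross-< : ∀ x y z w → x + w < z + y → x - y < z - w
  cross-< x y z w h = subst₂ _<_ (shift-down x y w) (shift-down' z y w) (ℤP.+-monoˡ-< (- y - w) h)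
    where shift-down' : ∀ z y w → z + y + (- y - w) ≡ z - w
          shift-down' = solve-∀

  cross-<⁻ : ∀ x y z w → x - y < z - w → x + w < z + y
  cross-<⁻ x y z w h = subst₂ _<_ (shift-up x y w) (shift-up' z y w) (ℤP.+-monoˡ-< (y + w) h)
    where shift-up' : ∀ z y w → z - w + (y + w) ≡ z + y
          shift-up' = solve-∀

  cross-≡ : ∀ x y z w → x + w ≡ z + y → x - y ≡ z - w
  cross-≡ x y z w h = trans (sym (shift-down x y w)) (trans (cong (_+ (- y - w)) h) (shift-down' z y w))
    where shift-down' : ∀ z y w → z + y + (- y - w) ≡ z - w
          shift-down' = solve-∀

  ℕ-diff-< : ∀ a b c d → a ℕ.+ d ℕ.< c ℕ.+ b → + a - + b < + c - + d
  ℕ-diff-< a b c d h = cross-< (+ a) (+ b) (+ c) (+ d) (subst₂ _<_ (ℤP.pos-+ a d) (ℤP.pos-+ c b) (+<+ h))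

  ℕ-diff-<⁻ : ∀ a b c d → + a - + b < + c - + d → a ℕ.+ d ℕ.< c ℕ.+ b
  ℕ-diff-<⁻ a b c d h = ℤP.drop‿+<+ (subst₂ _<_ (sym (ℤP.pos-+ a d)) (sym (ℤP.pos-+ c b)) (cross-<⁻ (+ a) (+ b) (+ c) (+ d) h))

  ℕ-diff-≡ : ∀ a b c d → a ℕ.+ d ≡ c ℕ.+ b → + a - + b ≡ + c - + d
  ℕ-diff-≡ a b c d h = cross-≡ (+ a) (+ b) (+ c) (+ d) (trans (sym (ℤP.pos-+ a d)) (trans (cong +_ h) (ℤP.pos-+ c b)))

  as-ℕ-diff : ∀ e → ∃[ x ] ∃[ y ] e ≡ + x - + y
  as-ℕ-diff (+ n)    = n , 0 , sym (ℤP.+-identityʳ (+ n))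
  as-ℕ-diff -[1+ n ] = 0 , suc n , refl

  pos-∸ : ∀ {m n} → n ℕ.≤ m → + (m ℕ.∸ n) ≡ + m - + n
  pos-∸ {m} {n} h = sym (trans (ℤP.m-n≡m⊖n m n) (ℤP.⊖-≥ h))

  <⇒+1≤ : ∀ {x y} → x < y → x + + 1 ≤ y
  <⇒+1≤ {x} {y} h = subst (_≤ y) (ℤP.+-comm (+ 1) x) (ℤP.i<j⇒suc[i]≤j h)

  +<⇒<− : ∀ a x y → a + x < y → x < y - a
  +<⇒<− a x y h = subst₂ _<_ (cancel a x) refl (ℤP.+-monoˡ-< (- a) h)
    where cancel : ∀ a x → a + x + - a ≡ x
          cancel = solve-∀

  <−⇒+< : ∀ a x y → x < y - a → a + x < y
  <−⇒+< a x y h = subst (a + x <_) (cancel a y) (ℤP.+-monoʳ-< a h)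
    where cancel : ∀ a y → a + (y - a) ≡ y
          cancel = solve-∀

  −<⇒<+ : ∀ u z x → u - z < x → u < z + x
  −<⇒<+ u z x h = subst₂ _<_ (cancel u z) refl (ℤP.+-monoʳ-< z h)
    where cancel : ∀ u z → z + (u - z) ≡ u
          cancel = solve-∀

  <+⇒−< : ∀ u z x → u < z + x → u - z < x
  <+⇒−< u z x h = subst₂ _<_ refl (cancel z x) (ℤP.+-monoˡ-< (- z) h)
    where cancel : ∀ z x → z + x - z ≡ x
          cancel = solve-∀

  0<* : ∀ {x y} → + 0 < x → + 0 < y → + 0 < x * y
  0<* {x} {y} hx hy = subst (_< x * y) (ℤP.*-zeroˡ y) (ℤP.*-monoʳ-<-pos y {{ℤ.positive hy}} hx)

open IntegerRearrangement

module RationalFractions where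

  open import Data.Nat as ℕ using (ℕ; suc)
  open import Data.Integer as ℤ using (ℤ; +_; +[1+_]; _+_; _*_; _-_; -_; _≤_; _<_)
  import Data.Integer.Properties as ℤP
  import Data.Integer.DivMod as ℤD
  import Data.Integer.GCD as ℤG
  open import Data.Integer.Tactic.RingSolver using (solve-∀)
  open import Data.Rational as ℚ using (ℚ; mkℚ; ↥_; ↧_; floor; ½)
  open import Data.Rational.Unnormalised as ℚᵘ using (ℚᵘ; mkℚᵘ; *≡*)
  import Data.Rational.Properties as ℚP
  open import Data.Product using (_×_; _,_)
  open import Relation.Binary.PropositionalEquality
  open import Function using (_$_)
  open import Defs using (ℤtoℚ)

  -- `Fractionᵘ q N d` says that q equals the (not necessarily reduced) fraction
  -- N / d, in cross-multiplied form.  It is a record so that N and d can be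
  -- inferred from the type.
  record Fractionᵘ (q : ℚᵘ) (N d : ℤ) : Set where
    constructor fraction
    field cross : ℚᵘ.↥ q * d ≡ N * ℚᵘ.↧ q

  Fraction : ℚ → ℤ → ℤ → Set
  Fraction p N d = Fractionᵘ (ℚ.toℚᵘ p) N d

  fractionᵘ-≃ : ∀ {x y N d} → x ℚᵘ.≃ y → Fractionᵘ y N d → Fractionᵘ x N d
  fractionᵘ-≃ {mkℚᵘ nx dx} {mkℚᵘ ny dy} {N} {d} (*≡* e) (fraction r) =
    fraction $ ℤP.*-cancelʳ-≡ _ _ (+[1+ dy ]) (begin
      (nx * d) * Y          ≡⟨ swap₂₃ nx d Y ⟩
      (nx * Y) * d          ≡⟨ cong (_* d) e ⟩
      (ny * X) * d          ≡⟨ swap₂₃ ny X d ⟩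
      (ny * d) * X          ≡⟨ cong (_* X) r ⟩
      (N * Y) * X           ≡⟨ swap₂₃ N Y X ⟩
      (N * X) * Y           ∎)
    where
      open ≡-Reasoning
      X = +[1+ dx ]
      Y = +[1+ dy ]
      swap₂₃ : ∀ u v w → (u * v) * w ≡ (u * w) * v
      swap₂₃ = solve-∀

  fractionᵘ-+ : ∀ {x y N₁ d₁ N₂ d₂} → Fractionᵘ x N₁ d₁ → Fractionᵘ y N₂ d₂
              → Fractionᵘ (x ℚᵘ.+ y) (N₁ * d₂ + N₂ * d₁) (d₁ * d₂)
  fractionᵘ-+ {mkℚᵘ nx dx} {mkℚᵘ ny dy} {N₁} {d₁} {N₂} {d₂} (fraction hx) (fraction hy) = fraction $ begin
      (nx * Y + ny * X) * (d₁ * d₂)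
        ≡⟨ expand nx ny X Y d₁ d₂ ⟩
      (nx * d₁) * (Y * d₂) + (ny * d₂) * (X * d₁)
        ≡⟨ cong₂ (λ u v → u * (Y * d₂) + v * (X * d₁)) hx hy ⟩
      (N₁ * X) * (Y * d₂) + (N₂ * Y) * (X * d₁)
        ≡⟨ collect N₁ N₂ X Y d₁ d₂ ⟩
      (N₁ * d₂ + N₂ * d₁) * (X * Y)
        ≡⟨ cong ((N₁ * d₂ + N₂ * d₁) *_) (sym (ℤP.pos-* (suc dx) (suc dy))) ⟩
      (N₁ * d₂ + N₂ * d₁) * + (suc dx ℕ.* suc dy) ∎
    where
      open ≡-Reasoning
      X = +[1+ dx ]
      Y = +[1+ dy ]
      expand : ∀ nx ny X Y d₁ d₂ → (nx * Y + ny * X) * (d₁ * d₂) ≡ (nx * d₁) * (Y * d₂) + (ny * d₂) * (X * d₁)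
      expand = solve-∀
      collect : ∀ N₁ N₂ X Y d₁ d₂ → (N₁ * X) * (Y * d₂) + (N₂ * Y) * (X * d₁) ≡ (N₁ * d₂ + N₂ * d₁) * (X * Y)
      collect = solve-∀

  fractionᵘ-neg : ∀ {x N d} → Fractionᵘ x N d → Fractionᵘ (ℚᵘ.- x) (- N) d
  fractionᵘ-neg {mkℚᵘ n dn} {N} {d} (fraction h) = fraction $ begin
    (- n) * d          ≡⟨ sym (ℤP.neg-distribˡ-* n d) ⟩
    - (n * d)          ≡⟨ cong -_ h ⟩
    - (N * +[1+ dn ])  ≡⟨ ℤP.neg-distribˡ-* N _ ⟩
    (- N) * +[1+ dn ]  ∎
    where open ≡-Reasoning

  fraction-+ : ∀ {p q N₁ d₁ N₂ d₂} → Fraction p N₁ d₁ → Fraction q N₂ d₂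
             → Fraction (p ℚ.+ q) (N₁ * d₂ + N₂ * d₁) (d₁ * d₂)
  fraction-+ {p} {q} hp hq = fractionᵘ-≃ (ℚP.toℚᵘ-homo-+ p q) (fractionᵘ-+ hp hq)

  fraction-neg : ∀ {p N d} → Fraction p N d → Fraction (ℚ.- p) (- N) d
  fraction-neg {p} h = fractionᵘ-≃ (ℚP.toℚᵘ-homo‿- p) (fractionᵘ-neg h)

  fraction-− : ∀ {p q N₁ d₁ N₂ d₂} → Fraction p N₁ d₁ → Fraction q N₂ d₂
             → Fraction (p ℚ.- q) (N₁ * d₂ + (- N₂) * d₁) (d₁ * d₂)
  fraction-− {p} {q} hp hq = fraction-+ hp (fraction-neg hq)

  fraction-/ : ∀ z n .{{_ : ℕ.NonZero n}} → Fraction (z ℚ./ n) z (+ n)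
  fraction-/ z n = fraction $ begin
    ℚᵘ.↥ (ℚ.toℚᵘ r) * + n ≡⟨ cong₂ _*_ (ℚP.↥ᵘ-toℚᵘ r) (sym (ℚP.↧-/ z n)) ⟩
    ↥ r * (↧ r * g)       ≡⟨ regroup (↥ r) (↧ r) g ⟩
    (↥ r * g) * ↧ r       ≡⟨ cong₂ _*_ (ℚP.↥-/ z n) (sym (ℚP.↧ᵘ-toℚᵘ r)) ⟩
    z * ℚᵘ.↧ (ℚ.toℚᵘ r)   ∎
    where
      open ≡-Reasoning
      r = z ℚ./ n
      g = ℤG.gcd z (+ n)
      regroup : ∀ x y g → x * (y * g) ≡ (x * g) * y
      regroup = solve-∀

  fractionᵘ-unique : ∀ {x N d N' d'} → Fractionᵘ x N d → Fractionᵘ x N' d' → N * d' ≡ N' * d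
  fractionᵘ-unique {mkℚᵘ n dn} {N} {d} {N'} {d'} (fraction h) (fraction h') = ℤP.*-cancelˡ-≡ X _ _ (begin
    X * (N * d')   ≡⟨ rotate X N d' ⟩
    (N * X) * d'   ≡⟨ cong (_* d') (sym h) ⟩
    (n * d) * d'   ≡⟨ swap₂₃ n d d' ⟩
    (n * d') * d   ≡⟨ cong (_* d) h' ⟩
    (N' * X) * d   ≡⟨ sym (rotate X N' d) ⟩
    X * (N' * d)   ∎)
    where
      open ≡-Reasoning
      X = +[1+ dn ]
      rotate : ∀ X N d → X * (N * d) ≡ (N * X) * d
      rotate = solve-∀
      swap₂₃ : ∀ u v w → (u * v) * w ≡ (u * w) * v
      swap₂₃ = solve-∀

  half-integer-shift : ∀ z y i → ℤtoℚ z ℚ.+ ½ ≡ ℤtoℚ y ℚ.- ℤtoℚ i ℚ.- ½ → z ≡ y - i - + 1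
  half-integer-shift z y i eq =
    ℤP.*-cancelˡ-≡ (+ 4) z (y - i - + 1)
      (+-cancelʳ-≡ (+ 4 * z) (+ 4 * (y - i - + 1)) (+ 2)
        (trans (lhs-normal z) (trans (sym cross) (rhs-normal y i))))
    where
      Nˡ = z * + 2 + + 1 * + 1
      dˡ = + 1 * + 2
      Nʳ = (y * + 1 + (- i) * + 1) * + 2 + (- + 1) * (+ 1 * + 1)
      dʳ = (+ 1 * + 1) * + 2
      left : Fraction (ℤtoℚ z ℚ.+ ½) Nˡ dˡ
      left = fraction-+ (fraction-/ z 1) (fraction-/ (+ 1) 2)
      right : Fraction (ℤtoℚ y ℚ.- ℤtoℚ i ℚ.- ½) Nʳ dʳ
      right = fraction-− (fraction-− (fraction-/ y 1) (fraction-/ i 1)) (fraction-/ (+ 1) 2)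
      cross : Nʳ * dˡ ≡ Nˡ * dʳ
      cross = fractionᵘ-unique (subst (λ q → Fraction q Nʳ dʳ) (sym eq) right) left
      lhs-normal : ∀ z → + 4 * z + + 2 ≡ (z * + 2 + + 1 * + 1) * ((+ 1 * + 1) * + 2)
      lhs-normal = solve-∀
      rhs-normal : ∀ y i → ((y * + 1 + (- i) * + 1) * + 2 + (- + 1) * (+ 1 * + 1)) * (+ 1 * + 2) ≡ + 4 * (y - i - + 1) + + 2
      rhs-normal = solve-∀

  floor-of-fraction : ∀ {q D A M} → Fraction q (D * M) (A * M) → + 0 < A → + 0 < M
                    → floor q * A ≤ D × D < (floor q + + 1) * A
  floor-of-fraction {mkℚ n dm _} {D} {A} {M} (fraction hq) 0<A 0<M = lower , upper
    where
      instance
        M-pos : ℤ.Positive M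
        M-pos = ℤ.positive 0<M
        M-nonNeg : ℤ.NonNegative M
        M-nonNeg = ℤ.nonNegative (ℤP.<⇒≤ 0<M)
        AM-pos : ℤ.Positive (A * M)
        AM-pos = ℤ.positive (0<* 0<A 0<M)
        AM-nonNeg : ℤ.NonNegative (A * M)
        AM-nonNeg = ℤ.nonNegative (ℤP.<⇒≤ (0<* 0<A 0<M))
      B = +[1+ dm ]
      f = n ℤD./ B
      fB≤n : f * B ≤ n
      fB≤n = ℤD.[n/d]*d≤n n B
      n<f+1B : n < (f + + 1) * B
      n<f+1B = subst₂ _<_ (sym (ℤD.a≡a%n+[a/n]*n n B)) (step f B)
                 (ℤP.+-monoˡ-< (f * B) (ℤ.+<+ (ℤD.n%d<d n B)))
        where step : ∀ f B → B + f * B ≡ (f + + 1) * B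
              step = solve-∀
      regroup : ∀ f A M → f * (A * M) ≡ (f * A) * M
      regroup = solve-∀
      swap : ∀ u v w → (u * v) * w ≡ (u * w) * v
      swap = solve-∀
      lower : f * A ≤ D
      lower = ℤP.*-cancelʳ-≤-pos (f * A) D M
                (ℤP.*-cancelʳ-≤-pos ((f * A) * M) (D * M) B
                  (subst₂ _≤_ (trans (swap f B (A * M)) (cong (_* B) (regroup f A M))) hq
                    (ℤP.*-monoʳ-≤-nonNeg (A * M) fB≤n)))
      upper : D < (f + + 1) * A
      upper = ℤP.*-cancelʳ-<-nonNeg M
                (ℤP.*-cancelʳ-<-nonNeg B
                  (subst₂ _<_ hq (trans (swap (f + + 1) B (A * M)) (cong (_* B) (regroup (f + + 1) A M)))
                    (ℤP.*-monoʳ-<-pos (A * M) n<f+1B)))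

open RationalFractions

module FiniteLists where

  open import Data.Nat as ℕ using (ℕ; zero; suc)
  open import Data.Integer using (ℤ; +_; _+_)
  import Data.Integer.Properties as ℤP
  open import Data.Fin as Fin using (Fin)
  import Data.Fin.Properties as FinP
  open import Data.List using (List; []; _∷_; _++_; length; map)
  open import Data.List.Properties using (length-++)
  open import Data.List.Relation.Unary.Unique.Propositional using (Unique; []; _∷_)
  import Data.List.Relation.Unary.Unique.Propositional.Properties as Unique
  import Data.List.Relation.Unary.All as All
  open import Data.List.Relation.Unary.Any using (here; there)
  open import Data.List.Membership.Propositional using (_∈_)
  import Data.List.Membership.Propositional.Properties as ∈
  open import Data.List.Membership.Propositional.Properties.WithK using (unique∧set⇒bag)
  open import Data.List.Relation.Binary.BagAndSetEquality using (∼bag⇒↭)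
  open import Data.List.Relation.Binary.Permutation.Propositional.Properties using (↭-length)
  open import Data.Product using (_×_; _,_; ∃-syntax)
  open import Data.Sum using (inj₁; inj₂)
  open import Function.Bundles using (_⇔_)
  open import Relation.Binary.PropositionalEquality
  open import Relation.Nullary using (¬_)
  open import Defs using (sumℤ)

  unique-length : ∀ {A : Set} {X Y : List A} → Unique X → Unique Y
                → (∀ z → z ∈ X ⇔ z ∈ Y) → length X ≡ length Y
  unique-length uX uY same = ↭-length (∼bag⇒↭ (unique∧set⇒bag uX uY (λ {z} → same z)))

  unique-map-on : ∀ {A B : Set} (f : A → B) {xs : List A} → Unique xs
    → (∀ {x y} → x ∈ xs → y ∈ xs → f x ≡ f y → x ≡ y) → Unique (map f xs)
  unique-map-on f {[]} [] inj = []
  unique-map-on f {x ∷ xs} (x∉xs ∷ uxs) inj =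
    All.tabulate fx-new ∷ unique-map-on f uxs (λ m m' → inj (there m) (there m'))
    where
      fx-new : ∀ {y} → y ∈ map f xs → f x ≢ y
      fx-new y∈ fx≡y with ∈.∈-map⁻ f y∈
      ... | x' , x'∈xs , refl = All.lookup x∉xs x'∈xs (inj (here refl) (there x'∈xs) fx≡y)

  concatFin : ∀ {A : Set} {n} → (Fin n → List A) → List A
  concatFin {n = zero}  g = []
  concatFin {n = suc n} g = g Fin.zero ++ concatFin (λ i → g (Fin.suc i))

  length-concatFin : ∀ {A : Set} {n} (g : Fin n → List A)
                   → + length (concatFin g) ≡ sumℤ (λ i → + length (g i))
  length-concatFin {n = zero}  g = refl
  length-concatFin {n = suc n} g = begin
    + length (g Fin.zero ++ rest)         ≡⟨ cong +_ (length-++ (g Fin.zero)) ⟩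
    + (length (g Fin.zero) ℕ.+ length rest) ≡⟨ ℤP.pos-+ (length (g Fin.zero)) (length rest) ⟩
    + length (g Fin.zero) + + length rest ≡⟨ cong (λ s → + length (g Fin.zero) + s) (length-concatFin (λ i → g (Fin.suc i))) ⟩
    sumℤ (λ i → + length (g i))           ∎
    where
      open ≡-Reasoning
      rest = concatFin (λ i → g (Fin.suc i))

  ∈-concatFin⁻ : ∀ {A : Set} {n} (g : Fin n → List A) {z} → z ∈ concatFin g → ∃[ i ] z ∈ g i
  ∈-concatFin⁻ {n = suc n} g m with ∈.∈-++⁻ (g Fin.zero) m
  ... | inj₁ m₀ = Fin.zero , m₀
  ... | inj₂ m' with ∈-concatFin⁻ (λ i → g (Fin.suc i)) m'
  ...   | i , mᵢ = Fin.suc i , mᵢ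

  ∈-concatFin⁺ : ∀ {A : Set} {n} (g : Fin n → List A) {z} i → z ∈ g i → z ∈ concatFin g
  ∈-concatFin⁺ {n = suc n} g Fin.zero    m = ∈.∈-++⁺ˡ m
  ∈-concatFin⁺ {n = suc n} g (Fin.suc i) m = ∈.∈-++⁺ʳ (g Fin.zero) (∈-concatFin⁺ (λ i → g (Fin.suc i)) i m)

  unique-concatFin : ∀ {A : Set} {n} (g : Fin n → List A) → (∀ i → Unique (g i))
    → (∀ i i' {z} → z ∈ g i → z ∈ g i' → i ≡ i') → Unique (concatFin g)
  unique-concatFin {n = zero}  g unique disjoint = []
  unique-concatFin {n = suc n} g unique disjoint =
    Unique.++⁺ (unique Fin.zero)
      (unique-concatFin (λ i → g (Fin.suc i)) (λ i → unique (Fin.suc i))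
         (λ i i' m m' → FinP.suc-injective (disjoint (Fin.suc i) (Fin.suc i') m m')))
      head-disjoint
    where
      head-disjoint : ∀ {v} → ¬ (v ∈ g Fin.zero × v ∈ concatFin (λ i → g (Fin.suc i)))
      head-disjoint (m₀ , m) with ∈-concatFin⁻ (λ i → g (Fin.suc i)) m
      ... | i , mᵢ with disjoint Fin.zero (Fin.suc i) m₀ mᵢ
      ...   | ()

  sumℤ-cong : ∀ {n} {f g : Fin n → ℤ} → (∀ i → f i ≡ g i) → sumℤ f ≡ sumℤ g
  sumℤ-cong {zero}  f≗g = refl
  sumℤ-cong {suc n} f≗g = cong₂ _+_ (f≗g Fin.zero) (sumℤ-cong (λ i → f≗g (Fin.suc i)))

open FiniteLists

module PartitionBoundary where

  open import Data.Nat as ℕ using (ℕ; zero; suc; _≤_; _<_; s≤s; z≤n; _≤?_)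
  import Data.Nat.Properties as ℕP
  open import Data.Integer as ℤ using (ℤ; +_; _+_; _-_; ∣_∣)
  import Data.Integer.Properties as ℤP
  open import Data.Integer.Tactic.RingSolver using (solve-∀)
  open import Data.List using (List; []; _∷_; length)
  open import Data.List.Properties using (filter-accept; filter-reject)
  open import Data.List.Relation.Unary.All using (All; []; _∷_)
  open import Data.List.Relation.Unary.Linked using (Linked; []; [-]; _∷_)
  open import Data.Product using (_×_; _,_; ∃-syntax; proj₁; proj₂)
  open import Data.Empty using (⊥-elim)
  open import Relation.Nullary using (¬_; yes; no)
  open import Relation.Binary.Definitions using (tri<; tri≈; tri>)
  open import Relation.Binary.PropositionalEquality
  open import Defs using (part; conj; content; hook)

  conj-∷-≥ : ∀ {x xs k} → k ≤ x → conj (x ∷ xs) k ≡ suc (conj xs k)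
  conj-∷-≥ h = cong length (filter-accept (_ ≤?_) h)

  conj-∷-< : ∀ {x xs k} → ¬ k ≤ x → conj (x ∷ xs) k ≡ conj xs k
  conj-∷-< h = cong length (filter-reject (_ ≤?_) h)

  conj-all-< : ∀ {xs k} → All (_< k) xs → conj xs k ≡ 0
  conj-all-< []       = refl
  conj-all-< (h ∷ hs) = trans (conj-∷-< (ℕP.<⇒≱ h)) (conj-all-< hs)

  head-bounds : ∀ {x xs} → Linked ℕ._≥_ (x ∷ xs) → All (_≤ x) xs
  head-bounds [-]             = []
  head-bounds {x} (y≤x ∷ l) = y≤x ∷ weaken y≤x (head-bounds l)
    where
      weaken : ∀ {y ys} → y ≤ x → All (_≤ y) ys → All (_≤ x) ys
      weaken y≤x []         = []
      weaken y≤x (z≤y ∷ zs) = ℕP.≤-trans z≤y y≤x ∷ weaken y≤x zs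

  linked-tail : ∀ {x xs} → Linked ℕ._≥_ (x ∷ xs) → Linked ℕ._≥_ xs
  linked-tail [-]     = []
  linked-tail (_ ∷ l) = l

  part-bounded : ∀ {x xs} → All (_≤ x) xs → ∀ j → part xs j ≤ x
  part-bounded []       j             = z≤n
  part-bounded (h ∷ hs) zero          = z≤n
  part-bounded (h ∷ hs) (suc zero)    = h
  part-bounded (h ∷ hs) (suc (suc j)) = part-bounded hs (suc j)

  all-< : ∀ {x xs k} → All (_≤ x) xs → x < k → All (_< k) xs
  all-< []       _   = []
  all-< (h ∷ hs) x<k = ℕP.≤-<-trans h x<k ∷ all-< hs x<k

  conj-duality : ∀ (p : List ℕ) → Linked ℕ._≥_ p → ∀ j k → 1 ≤ j → 1 ≤ k
    → (k ≤ part p j → j ≤ conj p k) × (j ≤ conj p k → k ≤ part p j)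
  conj-duality []       l j k (s≤s z≤n) (s≤s z≤n) = (λ ()) , (λ ())
  conj-duality (x ∷ xs) l (suc zero) k _ _ with k ≤? x
  ... | yes k≤x = (λ _ → subst (1 ≤_) (sym (conj-∷-≥ k≤x)) (s≤s z≤n)) , (λ _ → k≤x)
  ... | no  k≰x = (λ k≤x → ⊥-elim (k≰x k≤x))
                , (λ 1≤conj → ⊥-elim (ℕP.<-irrefl (sym conj≡0) 1≤conj))
    where conj≡0 = trans (conj-∷-< k≰x) (conj-all-< (all-< (head-bounds l) (ℕP.≰⇒> k≰x)))
  conj-duality (x ∷ xs) l (suc (suc j)) k _ 1≤k
    with k ≤? x | conj-duality xs (linked-tail l) (suc j) k (s≤s z≤n) 1≤k
  ... | yes k≤x | ih⇒ , ih⇐ =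
        (λ h → subst (suc (suc j) ≤_) (sym (conj-∷-≥ k≤x)) (s≤s (ih⇒ h)))
      , (λ h → ih⇐ (ℕP.≤-pred (subst (suc (suc j) ≤_) (conj-∷-≥ k≤x) h)))
  ... | no k≰x | _ =
        (λ h → ⊥-elim (k≰x (ℕP.≤-trans h (part-bounded (head-bounds l) (suc j)))))
      , (λ h → ⊥-elim (ℕP.<-irrefl (sym conj≡0) (ℕP.≤-trans (s≤s z≤n) h)))
    where conj≡0 = trans (conj-∷-< k≰x) (conj-all-< (all-< (head-bounds l) (ℕP.≰⇒> k≰x)))

  -- The boundary of the Young diagram of a partition λ, read as a bi-infinite
  -- 0/1-word (Maya diagram).
  module Boundary (p : List ℕ) (decreasing : Linked ℕ._≥_ p) where

    rowLen colLen : ℕ → ℕ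
    rowLen j = part p j
    colLen k = conj p k

    bead : ℕ → ℤ
    bead j = content p j

    gap : ℕ → ℤ
    gap k = + k - + suc (colLen k)

    IsBead : ℤ → Set
    IsBead e = ∃[ j ] (1 ≤ j × bead j ≡ e)

    cell⇒conj : ∀ {j k} → 1 ≤ j → 1 ≤ k → k ≤ rowLen j → j ≤ colLen k
    cell⇒conj hj hk = proj₁ (conj-duality p decreasing _ _ hj hk)

    conj⇒cell : ∀ {j k} → 1 ≤ j → 1 ≤ k → j ≤ colLen k → k ≤ rowLen j
    conj⇒cell hj hk = proj₂ (conj-duality p decreasing _ _ hj hk)

    rowLen-antitone : ∀ {i j} → 1 ≤ i → i ≤ j → rowLen j ≤ rowLen i
    rowLen-antitone {i} {j} hi i≤j with rowLen j in eq
    ... | zero  = z≤n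
    ... | suc m = conj⇒cell hi (s≤s z≤n)
                    (ℕP.≤-trans i≤j (cell⇒conj (ℕP.≤-trans hi i≤j) (s≤s z≤n) (ℕP.≤-reflexive (sym eq))))

    colLen-antitone : ∀ {k k'} → 1 ≤ k → k ≤ k' → colLen k' ≤ colLen k
    colLen-antitone {k} {k'} hk k≤k' with colLen k' in eq
    ... | zero  = z≤n
    ... | suc m = cell⇒conj (s≤s z≤n) hk
                    (ℕP.≤-trans k≤k' (conj⇒cell (s≤s z≤n) (ℕP.≤-trans hk k≤k') (ℕP.≤-reflexive (sym eq))))

    bead-decreasing : ∀ {i j} → 1 ≤ i → i < j → bead j ℤ.< bead i
    bead-decreasing {i} {j} hi i<j = ℕ-diff-< (rowLen j) j (rowLen i) i (ℕP.+-mono-≤-< (rowLen-antitone hi (ℕP.<⇒≤ i<j)) i<j)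

    gap-increasing : ∀ {k k'} → 1 ≤ k → k < k' → gap k ℤ.< gap k'
    gap-increasing {k} {k'} hk k<k' = ℕ-diff-< k (suc (colLen k)) k' (suc (colLen k')) (ℕP.+-mono-<-≤ k<k' (s≤s (colLen-antitone hk (ℕP.<⇒≤ k<k'))))

    bead-injective : ∀ {i j} → 1 ≤ i → 1 ≤ j → bead i ≡ bead j → i ≡ j
    bead-injective {i} {j} hi hj eq with ℕP.<-cmp i j
    ... | tri< i<j _ _ = ⊥-elim (ℤP.<-irrefl (sym eq) (bead-decreasing hi i<j))
    ... | tri≈ _ i≡j _ = i≡j
    ... | tri> _ _ j<i = ⊥-elim (ℤP.<-irrefl eq (bead-decreasing hj j<i))

    gap-injective : ∀ {k k'} → 1 ≤ k → 1 ≤ k' → gap k ≡ gap k' → k ≡ k'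
    gap-injective {k} {k'} hk hk' eq with ℕP.<-cmp k k'
    ... | tri< k<k' _ _ = ⊥-elim (ℤP.<-irrefl eq (gap-increasing hk k<k'))
    ... | tri≈ _ k≡k' _ = k≡k'
    ... | tri> _ _ k'<k = ⊥-elim (ℤP.<-irrefl (sym eq) (gap-increasing hk' k'<k))

    cell⇒gap<bead : ∀ {j k} → 1 ≤ j → 1 ≤ k → k ≤ rowLen j → gap k ℤ.< bead j
    cell⇒gap<bead {j} {k} hj hk h = ℕ-diff-< k (suc (colLen k)) (rowLen j) j (ℕP.+-mono-≤-< h (s≤s (cell⇒conj hj hk h)))

    non-cell⇒bead<gap : ∀ {j k} → 1 ≤ j → 1 ≤ k → ¬ k ≤ rowLen j → bead j ℤ.< gap k
    non-cell⇒bead<gap {j} {k} hj hk h =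
      ℕ-diff-< (rowLen j) j k (suc (colLen k)) (ℕP.+-mono-<-≤ (ℕP.≰⇒> h) (ℕP.≰⇒> (λ j≤col → h (conj⇒cell hj hk j≤col))))

    gap<bead⇒cell : ∀ {j k} → 1 ≤ j → 1 ≤ k → gap k ℤ.< bead j → k ≤ rowLen j
    gap<bead⇒cell {j} {k} hj hk h with k ≤? rowLen j
    ... | yes cell = cell
    ... | no  k≰λ  = ⊥-elim (ℤP.<-asym h (non-cell⇒bead<gap hj hk k≰λ))

    gap-not-bead : ∀ {k} → 1 ≤ k → ¬ IsBead (gap k)
    gap-not-bead {k} hk (j , hj , eq) with k ≤? rowLen j
    ... | yes cell = ℤP.<-irrefl (sym eq) (cell⇒gap<bead hj hk cell)
    ... | no  k≰λ  = ℤP.<-irrefl eq (non-cell⇒bead<gap hj hk k≰λ)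

    hook≡bead-gap : ∀ {j k} → 1 ≤ j → 1 ≤ k → k ≤ rowLen j → + hook p (j , k) ≡ bead j - gap k
    hook≡bead-gap {j} {k} hj hk h = begin
      + ((rowLen j ℕ.∸ k) ℕ.+ (colLen k ℕ.∸ j) ℕ.+ 1)
        ≡⟨ ℤP.pos-+ ((rowLen j ℕ.∸ k) ℕ.+ (colLen k ℕ.∸ j)) 1 ⟩
      + ((rowLen j ℕ.∸ k) ℕ.+ (colLen k ℕ.∸ j)) + + 1
        ≡⟨ cong (_+ + 1) (ℤP.pos-+ (rowLen j ℕ.∸ k) (colLen k ℕ.∸ j)) ⟩
      + (rowLen j ℕ.∸ k) + + (colLen k ℕ.∸ j) + + 1
        ≡⟨ cong₂ (λ u v → u + v + + 1) (pos-∸ h) (pos-∸ (cell⇒conj hj hk h)) ⟩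
      (+ rowLen j - + k) + (+ colLen k - + j) + + 1
        ≡⟨ regroup (+ rowLen j) (+ k) (+ colLen k) (+ j) ⟩
      (+ rowLen j - + j) - (+ k - (+ 1 + + colLen k))
        ≡⟨ cong (λ u → (+ rowLen j - + j) - (+ k - u)) (sym (ℤP.pos-+ 1 (colLen k))) ⟩
      bead j - gap k ∎
      where
        open ≡-Reasoning
        regroup : ∀ L K C J → (L - K) + (C - J) + + 1 ≡ (L - J) - (K - (+ 1 + C))
        regroup = solve-∀

    -- Everything strictly between two consecutive gaps is a bead: it is the
    -- bead of the row j = e + colLen(k+1) ... whose length is exactly k.
    between-gaps⇒bead : ∀ {k e} → 1 ≤ k → gap k ℤ.< e → e ℤ.< gap (suc k) → IsBead e
    between-gaps⇒bead {k} {e} hk gap<e e<gap with as-ℕ-diff e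
    ... | x , y , refl = j , 1≤j , bead-j
      where
        s = k ℕ.+ y
        lower : s < x ℕ.+ suc (colLen k)
        lower = ℕ-diff-<⁻ k (suc (colLen k)) x y gap<e
        upper : x ℕ.+ colLen (suc k) < s
        upper = subst (_≤ s) (ℕP.+-suc x _) (ℕP.≤-pred (ℕ-diff-<⁻ x y (suc k) (suc (colLen (suc k))) e<gap))
        x≤s : x ≤ s
        x≤s = ℕP.≤-trans (ℕP.m≤m+n x _) (ℕP.<⇒≤ upper)
        j = s ℕ.∸ x
        j+x≡s : j ℕ.+ x ≡ s
        j+x≡s = ℕP.m∸n+n≡m x≤s
        j≤colLen : j ≤ colLen k
        j≤colLen = ℕP.≤-pred (ℕP.+-cancelʳ-< x j (suc (colLen k))
                     (subst₂ _<_ (sym j+x≡s) (ℕP.+-comm x (suc (colLen k))) lower))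
        colLen<j : colLen (suc k) < j
        colLen<j = ℕP.+-cancelʳ-< x _ j (subst₂ _<_ (ℕP.+-comm x _) (sym j+x≡s) upper)
        1≤j : 1 ≤ j
        1≤j = ℕP.≤-trans (s≤s z≤n) colLen<j
        rowLen≡k : rowLen j ≡ k
        rowLen≡k = ℕP.≤-antisym
          (ℕP.≮⇒≥ (λ k<λ → ℕP.<⇒≱ colLen<j (cell⇒conj 1≤j (s≤s z≤n) k<λ)))
          (conj⇒cell 1≤j hk j≤colLen)
        bead-j : bead j ≡ + x - + y
        bead-j = ℕ-diff-≡ (rowLen j) j x y
                   (trans (cong (ℕ._+ y) rowLen≡k) (trans (sym j+x≡s) (ℕP.+-comm j x)))

    -- Everything below the first gap is a bead (of an empty row).
    below-gap₁⇒bead : ∀ {e} → e ℤ.< gap 1 → IsBead e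
    below-gap₁⇒bead {e} e<gap with as-ℕ-diff e
    ... | x , y , refl = j , 1≤j , bead-j
      where
        upper : x ℕ.+ colLen 1 < y
        upper = subst (_≤ y) (ℕP.+-suc x _) (ℕP.≤-pred (ℕ-diff-<⁻ x y 1 (suc (colLen 1)) e<gap))
        x≤y : x ≤ y
        x≤y = ℕP.≤-trans (ℕP.m≤m+n x _) (ℕP.<⇒≤ upper)
        j = y ℕ.∸ x
        j+x≡y : j ℕ.+ x ≡ y
        j+x≡y = ℕP.m∸n+n≡m x≤y
        colLen<j : colLen 1 < j
        colLen<j = ℕP.+-cancelʳ-< x _ j (subst₂ _<_ (ℕP.+-comm x _) (sym j+x≡y) upper)
        1≤j : 1 ≤ j
        1≤j = ℕP.≤-trans (s≤s z≤n) colLen<j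
        rowLen≡0 : rowLen j ≡ 0
        rowLen≡0 = ℕP.n≤0⇒n≡0 (ℕP.≮⇒≥ (λ 0<λ → ℕP.<⇒≱ colLen<j (cell⇒conj 1≤j (s≤s z≤n) 0<λ)))
        bead-j : bead j ≡ + x - + y
        bead-j = ℕ-diff-≡ (rowLen j) j x y
                   (trans (cong (ℕ._+ y) rowLen≡0) (trans (sym j+x≡y) (ℕP.+-comm j x)))

    -- Every integer that is not a bead is a gap: starting from gap 1 ≤ e,
    -- walk up the increasing gaps; skipping over e would put e between two gaps.
    non-bead⇒gap : ∀ {e} → ¬ IsBead e → ∃[ k ] (1 ≤ k × gap k ≡ e)
    non-bead⇒gap {e} ¬bead = walk ∣ e - gap 1 ∣ 1 (s≤s z≤n) gap₁≤e (ℤP.≤-reflexive (sym e≡gap₁+dist))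
      where
        gap₁≤e : gap 1 ℤ.≤ e
        gap₁≤e = ℤP.≮⇒≥ (λ e<gap → ¬bead (below-gap₁⇒bead e<gap))
        e≡gap₁+dist : gap 1 + + ∣ e - gap 1 ∣ ≡ e
        e≡gap₁+dist = trans (cong (λ n → gap 1 + n) (ℤP.0≤i⇒+∣i∣≡i (ℤP.i≤j⇒0≤j-i gap₁≤e))) (add-back (gap 1) e)
          where add-back : ∀ a e → a + (e - a) ≡ e
                add-back = solve-∀
        one-step : ∀ g N → g + + suc N ≡ (g + + 1) + + N
        one-step g N = trans (cong (λ n → g + n) (ℤP.pos-+ 1 N)) (sym (ℤP.+-assoc g (+ 1) (+ N)))
        -- invariant: gap k ≤ e ≤ gap k + N
        walk : ∀ N k → 1 ≤ k → gap k ℤ.≤ e → e ℤ.≤ gap k + + N → ∃[ k ] (1 ≤ k × gap k ≡ e)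
        walk N k hk gap≤e e≤ with gap k ℤ.≟ e
        ... | yes hit = k , hk , hit
        ... | no miss with e ℤ.<? gap (suc k)
        ...   | yes e<next = ⊥-elim (¬bead (between-gaps⇒bead hk (ℤP.≤∧≢⇒< gap≤e miss) e<next))
        ...   | no  e≮next with N
        ...     | zero = ⊥-elim (ℤP.<-irrefl refl
                           (ℤP.<-≤-trans (ℤP.≤∧≢⇒< gap≤e miss) (subst (e ℤ.≤_) (ℤP.+-identityʳ (gap k)) e≤)))
        ...     | suc N' = walk N' (suc k) (s≤s z≤n) (ℤP.≮⇒≥ e≮next)
                    (ℤP.≤-trans e≤ (subst (ℤ._≤ gap (suc k) + + N') (sym (one-step (gap k) N'))
                       (ℤP.+-monoˡ-≤ (+ N') (<⇒+1≤ (gap-increasing hk (ℕP.n<1+n k))))))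

open PartitionBoundary

module CoreAbacus where

  open import Data.Nat as ℕ using (ℕ; suc; s≤s; z≤n)
  import Data.Nat.Divisibility as ℕD
  open import Data.Integer using (ℤ; +_; _+_; _*_; _-_; -_; _≤_; _<_; +≤+; +<+; ∣_∣)
  import Data.Integer.Properties as ℤP
  import Data.Integer.DivMod as ℤD
  import Data.Integer.Divisibility as ℤDiv
  import Data.Integer.Divisibility.Signed as ℤDivₛ
  open import Data.Integer.Tactic.RingSolver using (solve-∀)
  open import Data.Rational as ℚ using (½)
  open import Data.Fin using (Fin; toℕ; fromℕ<)
  import Data.Fin.Properties as FinP
  open import Data.List using (List)
  open import Data.List.Relation.Unary.Linked using (Linked)
  open import Data.Product using (_×_; _,_; ∃-syntax; proj₂)
  open import Data.Empty using (⊥; ⊥-elim)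
  open import Relation.Nullary using (¬_)
  open import Relation.Binary.Definitions using (tri<; tri≈; tri>)
  open import Relation.Binary.PropositionalEquality
  open import Function.Bundles using (Equivalence)
  open import Defs using (IsCoreOf; IsARow; ℤtoℚ)

  -- The a-abacus of λ = core_a(c): the integers are laid out on a runners,
  -- position (m , i) holding m·a - i - 1, and the beads of λ on runner i are
  -- exactly the positions of level m ≤ -c_i.
  module Abacus (k0 : ℕ) (c : Fin (suc k0) → ℤ) (p : List ℕ) (decreasing : Linked ℕ._≥_ p)
                (core : IsCoreOf (suc k0) c p) where

    open Boundary p decreasing public

    a : ℕ
    a = suc k0

    A : ℤ
    A = + a

    position : ℤ → Fin a → ℤ
    position m i = m * A - + toℕ i - + 1

    top : Fin a → ℤ
    top i = position (- c i) i

    IsTop : ℤ → Set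
    IsTop v = ∃[ i ] v ≡ top i

    private
      diff≡0⇒≡ : ∀ {x y} → x - y ≡ + 0 → x ≡ y
      diff≡0⇒≡ {x} {y} h = trans (sym (add-back x y)) (trans (cong (_+ y) h) (ℤP.+-identityˡ y))
        where add-back : ∀ x y → x - y + y ≡ x
              add-back = solve-∀

      level-difference : ∀ m m' (i i' : Fin a) → position m i ≡ position m' i'
                       → (m - m') * A ≡ + toℕ i - + toℕ i'
      level-difference m m' i i' eq =
        trans (unfold m m' A I I')
          (trans (cong (λ v → (v + I + + 1) - (position m' i' + I' + + 1)) eq) (cancel (position m' i') I I'))
        where
          I = + toℕ i
          I' = + toℕ i'
          unfold : ∀ m m' A I I' → (m - m') * A ≡ (m * A - I - + 1 + I + + 1) - (m' * A - I' - + 1 + I' + + 1)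
          unfold = solve-∀
          cancel : ∀ v I I' → (v + I + + 1) - (v + I' + + 1) ≡ I - I'
          cancel = solve-∀

      runner-difference-< : ∀ (i i' : Fin a) → + toℕ i - + toℕ i' < A
      runner-difference-< i i' = ℤP.≤-<-trans (ℤP.i≤j⇒i-k≤j (+ toℕ i') ℤP.≤-refl) (+<+ (FinP.toℕ<n i))

      runner-difference-> : ∀ (i i' : Fin a) → - A < + toℕ i - + toℕ i'
      runner-difference-> i i' = ℤP.<-≤-trans (ℤP.neg-mono-< (+<+ (FinP.toℕ<n i')))
        (subst (_≤ + toℕ i - + toℕ i') (ℤP.+-identityˡ (- + toℕ i')) (ℤP.+-monoˡ-≤ (- + toℕ i') (+≤+ z≤n)))

    -- Positions are distinct: equal positions have equal level and runner,
    -- since |i - i'| < a forces the difference of levels to vanish.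
    position-injective : ∀ m m' (i i' : Fin a) → position m i ≡ position m' i' → m ≡ m' × i ≡ i'
    position-injective m m' i i' eq with ℤP.<-cmp (m - m') (+ 0) | level-difference m m' i i' eq
    ... | tri< m-m'<0 _ _ | levels = ⊥-elim (ℤP.<-irrefl refl
            (ℤP.<-≤-trans (runner-difference-> i i') (ℤP.≤-trans (ℤP.≤-reflexive (sym levels)) ≤-A)))
      where
        ≤-A : (m - m') * A ≤ - A
        ≤-A = subst ((m - m') * A ≤_) (ℤP.-1*i≡-i A) (ℤP.*-monoʳ-≤-nonNeg A (ℤP.i<j⇒i≤pred[j] m-m'<0))
    ... | tri≈ _ m-m'≡0 _ | levels = diff≡0⇒≡ m-m'≡0
          , FinP.toℕ-injective (ℤP.+-injective (diff≡0⇒≡ (trans (sym levels) (trans (cong (_* A) m-m'≡0) (ℤP.*-zeroˡ A)))))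
    ... | tri> _ _ 0<m-m' | levels = ⊥-elim (ℤP.<-irrefl refl
            (ℤP.<-≤-trans (runner-difference-< i i') (ℤP.≤-trans A≤ (ℤP.≤-reflexive levels))))
      where
        A≤ : A ≤ (m - m') * A
        A≤ = subst (_≤ (m - m') * A) (ℤP.*-identityˡ A) (ℤP.*-monoʳ-≤-nonNeg A (ℤP.i<j⇒suc[i]≤j 0<m-m'))

    position-monotone : ∀ {m m'} (i : Fin a) → m ≤ m' → position m i ≤ position m' i
    position-monotone i m≤m' = ℤP.+-monoˡ-≤ (- + 1) (ℤP.+-monoˡ-≤ (- + toℕ i) (ℤP.*-monoʳ-≤-nonNeg A m≤m'))

    position-shift : ∀ m t (i : Fin a) → position m i + t * A ≡ position (m + t) i
    position-shift m t i = shift m t A (+ toℕ i)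
      where shift : ∀ m t A I → (m * A - I - + 1) + t * A ≡ (m + t) * A - I - + 1
            shift = solve-∀

    -- Every integer is a position: write -e-1 = q·a + r with 0 ≤ r < a.
    every-integer-is-a-position : ∀ e → ∃[ i ] ∃[ m ] e ≡ position m i
    every-integer-is-a-position e =
      fromℕ< r<a , - q ,
      trans (reflect e) (trans (reflect-division x (+ r) q A (ℤD.a≡a%n+[a/n]*n x A))
        (cong (λ v → (- q) * A - + v - + 1) (sym (FinP.toℕ-fromℕ< r<a))))
      where
        x = - e - + 1
        r = x ℤD.% A
        q = x ℤD./ A
        r<a : r ℕ.< a
        r<a = ℤD.n%d<d x A
        reflect : ∀ e → e ≡ - (- e - + 1) - + 1
        reflect = solve-∀
        reflect-division : ∀ x r q A → x ≡ r + q * A → - x - + 1 ≡ (- q) * A - r - + 1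
        reflect-division x r q A h = trans (cong (λ v → - v - + 1) h) (negate r q A)
          where negate : ∀ r q A → - (r + q * A) - + 1 ≡ (- q) * A - r - + 1
                negate = solve-∀

    -- The defining property of core_a(c), read on integers instead of half-integers.
    bead⇒position : ∀ {e} → IsBead e → ∃[ i ] ∃[ m ] (m ≤ - c i × e ≡ position m i)
    bead⇒position (j , hj , refl) with Equivalence.to (core (ℤtoℚ (bead j) ℚ.+ ½)) (j , hj , refl)
    ... | i , m , m≤ , eq = i , m , m≤ , half-integer-shift (bead j) (m * A) (+ toℕ i) eq

    position⇒bead : ∀ {m} (i : Fin a) → m ≤ - c i → IsBead (position m i)
    position⇒bead {m} i m≤ with Equivalence.from (core (ℤtoℚ (m * A) ℚ.- ℤtoℚ (+ toℕ i) ℚ.- ½)) (i , m , m≤ , refl)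
    ... | j , hj , eq = j , hj , half-integer-shift (bead j) (m * A) (+ toℕ i) (sym eq)

    top-is-bead : ∀ i → IsBead (top i)
    top-is-bead i = position⇒bead i ℤP.≤-refl

    congruent⇒same-runner : ∀ {m m'} (i i' : Fin a) → ℤDiv._∣_ A (position m' i' - position m i) → i' ≡ i
    congruent⇒same-runner {m} {m'} i i' a∣ with ℤDivₛ.∣ᵤ⇒∣ {A} {position m' i' - position m i} a∣
    ... | ℤDivₛ.divides q eq = proj₂ (position-injective m' (m + q) i' i (begin
      position m' i'                                  ≡⟨ sym (add-back (position m' i') (position m i)) ⟩
      (position m' i' - position m i) + position m i  ≡⟨ cong (_+ position m i) eq ⟩
      q * A + position m i                            ≡⟨ ℤP.+-comm (q * A) (position m i) ⟩
      position m i + q * A                            ≡⟨ position-shift m q i ⟩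
      position (m + q) i                              ∎))
      where
        open ≡-Reasoning
        add-back : ∀ x y → x - y + y ≡ x
        add-back = solve-∀

    blocked-by-next-bead : ∀ {j j'} → IsARow a p j → 1 ℕ.≤ j' → bead j' ≡ bead j + A → ⊥
    blocked-by-next-bead {j} {j'} (_ , maximal) hj' next =
      ℤP.<⇒≱ bead<next (maximal j' hj' a∣difference)
      where
        a∣difference : ℤDiv._∣_ A (bead j' - bead j)
        a∣difference = subst (λ w → a ℕD.∣ ∣ w ∣) (sym (trans (cong (_- bead j) next) (add-sub (bead j) A))) ℕD.∣-refl
          where add-sub : ∀ x A → x + A - x ≡ A
                add-sub = solve-∀
        bead<next : bead j < bead j'
        bead<next = subst (bead j <_) (sym next)
                      (subst (_< bead j + A) (ℤP.+-identityʳ (bead j)) (ℤP.+-monoʳ-< (bead j) (+<+ (s≤s z≤n))))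

    a-row⇒top : ∀ {j} → IsARow a p j → IsTop (bead j)
    a-row⇒top {j} row@(hj , _) =
      let i , m , m≤ , bead≡ = bead⇒position (j , hj , refl)
          not-below : ¬ m < - c i
          not-below m< =
            let j' , hj' , bead≡' = position⇒bead {m + + 1} i (<⇒+1≤ m<)
            in blocked-by-next-bead row hj' (begin
                 bead j'                  ≡⟨ bead≡' ⟩
                 position (m + + 1) i     ≡⟨ sym (position-shift m (+ 1) i) ⟩
                 position m i + + 1 * A   ≡⟨ cong₂ _+_ (sym bead≡) (ℤP.*-identityˡ A) ⟩
                 bead j + A               ∎)
      in i , trans bead≡ (cong (λ v → position v i) {m} { - c i} (ℤP.≤-antisym m≤ (ℤP.≮⇒≥ not-below)))
      where open ≡-Reasoning

    top⇒a-row : ∀ {j} → 1 ℕ.≤ j → IsTop (bead j) → IsARow a p j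
    top⇒a-row {j} hj (i , bead≡top) = hj , maximal
      where
        maximal : ∀ j' → 1 ℕ.≤ j' → ℤDiv._∣_ A (bead j' - bead j) → bead j' ≤ bead j
        maximal j' hj' a∣ =
          let i' , m' , m'≤ , bead≡ = bead⇒position (j' , hj' , refl)
              i'≡i = congruent⇒same-runner { - c i} {m'} i i'
                       (subst₂ (λ u v → ℤDiv._∣_ A (u - v)) bead≡ bead≡top a∣)
              below-top : position m' i ≤ top i
              below-top = position-monotone i (subst (λ r → m' ≤ - c r) i'≡i m'≤)
          in subst₂ _≤_ (sym (trans bead≡ (cong (position m') i'≡i))) (sym bead≡top) below-top

    above-top-not-bead : ∀ u t → 1 ℕ.≤ t → ¬ IsBead (top u + + t * A)
    above-top-not-bead u t ht bead =
      let i , m , m≤ , eq = bead⇒position bead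
          level≡ , u≡i = position-injective (- c u + + t) m u i (trans (sym (position-shift (- c u) (+ t) u)) eq)
          above≤top : - c u + + t ≤ - c u
          above≤top = subst (λ r → - c u + + t ≤ - c r) (sym u≡i) (subst (_≤ - c i) (sym level≡) m≤)
      in ℤP.<⇒≱ (+<+ ht)
           (+-cancelʳ-≤ (+ t) (+ 0) (- c u)
             (subst₂ _≤_ (ℤP.+-comm (- c u) (+ t)) (sym (ℤP.+-identityˡ (- c u))) above≤top))

    above-level⇒above-top : ∀ m i → - c i < m → ∃[ t ] (1 ℕ.≤ t × position m i ≡ top i + + t * A)
    above-level⇒above-top m i top<m = ∣ T ∣ , 1≤t , (begin
      position m i                 ≡⟨ cong (λ v → position v i) {m} { - c i + T} (sym (add-back m (- c i))) ⟩
      position (- c i + T) i       ≡⟨ sym (position-shift (- c i) T i) ⟩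
      top i + T * A                ≡⟨ cong (λ w → top i + w * A) (sym +t≡T) ⟩
      top i + + ∣ T ∣ * A          ∎)
      where
        open ≡-Reasoning
        T = m - (- c i)
        add-back : ∀ m C → C + (m - C) ≡ m
        add-back = solve-∀
        0<T : + 0 < T
        0<T = subst (_< T) (ℤP.+-inverseʳ (- c i)) (ℤP.+-monoˡ-< (- (- c i)) top<m)
        +t≡T : + ∣ T ∣ ≡ T
        +t≡T = ℤP.0≤i⇒+∣i∣≡i (ℤP.<⇒≤ 0<T)
        1≤t : 1 ℕ.≤ ∣ T ∣
        1≤t = ℤP.drop‿+<+ (subst (+ 0 <_) (sym +t≡T) 0<T)

    non-bead⇒above-top : ∀ {e} → ¬ IsBead e → ∃[ u ] ∃[ t ] (1 ℕ.≤ t × e ≡ top u + + t * A)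
    non-bead⇒above-top {e} ¬bead =
      let i , m , e≡ = every-integer-is-a-position e
          not-bead-level : ¬ m ≤ - c i
          not-bead-level m≤ = ¬bead (subst IsBead (sym e≡) (position⇒bead i m≤))
          t , 1≤t , above = above-level⇒above-top m i (ℤP.≰⇒> not-bead-level)
      in i , t , 1≤t , trans e≡ above

open CoreAbacus

module FloorDifferences where

  open import Data.Nat as ℕ using (ℕ; suc; s≤s; z≤n)
  open import Data.Integer using (ℤ; +_; _+_; _*_; _-_; -_; _≤_; _<_; +≤+; +<+; _⊔_; ∣_∣)
  import Data.Integer.Properties as ℤP
  open import Data.Integer.Tactic.RingSolver using (solve-∀)
  open import Data.Rational as ℚ using (ℚ; floor)
  open import Data.Fin using (Fin; toℕ)
  open import Data.List using (List)
  open import Data.List.Relation.Unary.Linked using (Linked)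
  open import Data.Product using (_×_; _,_; proj₁; proj₂)
  open import Data.Sum using (inj₁; inj₂)
  open import Data.Empty using (⊥-elim)
  open import Relation.Binary.PropositionalEquality
  open import Defs using (IsCoreOf; xvec; floor₀)

  ≤0⊔⇒≤ : ∀ {t x} → 1 ℕ.≤ t → + t ≤ + 0 ⊔ x → + t ≤ x
  ≤0⊔⇒≤ {t} {x} ht h with ℤP.≤-total (+ 0) x
  ... | inj₁ 0≤x = subst (+ t ≤_) (ℤP.i≤j⇒i⊔j≡j 0≤x) h
  ... | inj₂ x≤0 = ⊥-elim (ℤP.<⇒≱ (+<+ ht) (subst (+ t ≤_) (ℤP.i≥j⇒i⊔j≡i x≤0) h))

  ≤⇒≤0⊔ : ∀ {t x} → + t ≤ x → + t ≤ + 0 ⊔ x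
  ≤⇒≤0⊔ {t} {x} h = ℤP.≤-trans h (ℤP.i≤j⊔i (+ 0) x)

  0⊔<⇒< : ∀ {t x} → + 0 ⊔ x < + t → x < + t
  0⊔<⇒< {t} {x} h = ℤP.≤-<-trans (ℤP.i≤j⊔i (+ 0) x) h

  <⇒0⊔< : ∀ {t x} → 1 ℕ.≤ t → x < + t → + 0 ⊔ x < + t
  <⇒0⊔< {t} {x} ht h with ℤP.≤-total (+ 0) x
  ... | inj₁ 0≤x = subst (_< + t) (sym (ℤP.i≤j⇒i⊔j≡j 0≤x)) h
  ... | inj₂ x≤0 = subst (_< + t) (sym (ℤP.i≥j⇒i⊔j≡i x≤0)) (+<+ ht)

  -- With x = c + s as in the theorem,  x_u - x_w = (top w - top u) / a, so the
  -- floors in the skew-length formula are integer quotients of differences of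
  -- top beads, and they count the gaps  top u + t·a  lying in given windows
  -- below top w.
  module Floors (k0 : ℕ) (c : Fin (suc k0) → ℤ) (p : List ℕ) (decreasing : Linked ℕ._≥_ p)
                (core : IsCoreOf (suc k0) c p) (b : ℕ) where

    open Abacus k0 c p decreasing core public

    x : Fin a → ℚ
    x i = xvec a c i

    D : Fin a → Fin a → ℤ
    D u w = top w - top u

    private
      A₂ Q M : ℤ
      A₂ = + (2 ℕ.* a)
      Q = + 1 * (A * A₂)
      M = A₂ * Q

      0<A : + 0 < A
      0<A₂ : + 0 < A₂
      0<M : + 0 < M
      0<A = +<+ (s≤s z≤n)
      0<A₂ = +<+ (s≤s z≤n)
      0<M = 0<* {A₂} {Q} 0<A₂ (0<* {+ 1} {A * A₂} (+<+ (s≤s z≤n)) (0<* {A} {A₂} 0<A 0<A₂))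

      -- x i = (2a·c_i + 2i - (a-1)) / 2a, written over the common denominator Q.
      X : Fin a → ℤ
      X i = c i * (A * A₂) + (+ toℕ i * A₂ + (- + k0) * A) * + 1

      x-fraction : ∀ i → Fraction (x i) (X i) Q
      x-fraction i = fraction-+ (fraction-/ (c i) 1)
                       (fraction-− (fraction-/ (+ toℕ i) a) (fraction-/ (+ k0) (2 ℕ.* a)))

      numerator≡ : ∀ u w → X u * Q + (- X w) * Q ≡ D u w * M
      numerator≡ u w = normalise (c u) (c w) (+ toℕ u) (+ toℕ w) (+ k0) A A₂
        where
          normalise : ∀ cu cw Iu Iw K A A₂
            → (cu * (A * A₂) + (Iu * A₂ + (- K) * A) * + 1) * (+ 1 * (A * A₂))
              + (- (cw * (A * A₂) + (Iw * A₂ + (- K) * A) * + 1)) * (+ 1 * (A * A₂))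
            ≡ (((- cw) * A - Iw - + 1) - ((- cu) * A - Iu - + 1)) * (A₂ * (+ 1 * (A * A₂)))
          normalise = solve-∀

      denominator≡ : Q * Q ≡ A * M
      denominator≡ = normalise A A₂
        where normalise : ∀ A A₂ → (+ 1 * (A * A₂)) * (+ 1 * (A * A₂)) ≡ A * (A₂ * (+ 1 * (A * A₂)))
              normalise = solve-∀

    difference-fraction : ∀ u w → Fraction (x u ℚ.- x w) (D u w * M) (A * M)
    difference-fraction u w =
      subst₂ (Fraction (x u ℚ.- x w)) (numerator≡ u w) denominator≡ (fraction-− (x-fraction u) (x-fraction w))

    shifted-fraction : ∀ u w → Fraction (x u ℚ.- x w ℚ.- (+ b) ℚ./ a) ((D u w - + b) * (M * A)) (A * (M * A))
    shifted-fraction u w =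
      subst₂ (Fraction (x u ℚ.- x w ℚ.- (+ b) ℚ./ a)) (regroup (D u w) M A (+ b)) (reassoc A M)
        (fraction-− (difference-fraction u w) (fraction-/ (+ b) a))
      where
        regroup : ∀ D M A B → D * M * A + (- B) * (A * M) ≡ (D - B) * (M * A)
        regroup = solve-∀
        reassoc : ∀ A M → A * M * A ≡ A * (M * A)
        reassoc = solve-∀

    ⌊x⌋ ⌊x-b⌋ : Fin a → Fin a → ℤ
    ⌊x⌋ u w = floor (x u ℚ.- x w)
    ⌊x-b⌋ u w = floor (x u ℚ.- x w ℚ.- (+ b) ℚ./ a)

    ⌊x⌋-spec : ∀ u w → ⌊x⌋ u w * A ≤ D u w × D u w < (⌊x⌋ u w + + 1) * A
    ⌊x⌋-spec u w = floor-of-fraction (difference-fraction u w) 0<A 0<M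

    ⌊x-b⌋-spec : ∀ u w → ⌊x-b⌋ u w * A ≤ D u w - + b × D u w - + b < (⌊x-b⌋ u w + + 1) * A
    ⌊x-b⌋-spec u w = floor-of-fraction (shifted-fraction u w) 0<A (0<* {M} {A} 0<M 0<A)

    upper lower : Fin a → Fin a → ℕ
    upper u w = ∣ floor₀ (x u ℚ.- x w) ∣
    lower u w = ∣ floor₀ (x u ℚ.- x w ℚ.- (+ b) ℚ./ a) ∣

    +upper : ∀ u w → + upper u w ≡ floor₀ (x u ℚ.- x w)
    +upper u w = ℤP.0≤i⇒+∣i∣≡i (ℤP.i≤i⊔j (+ 0) (⌊x⌋ u w))

    +lower : ∀ u w → + lower u w ≡ floor₀ (x u ℚ.- x w ℚ.- (+ b) ℚ./ a)
    +lower u w = ℤP.0≤i⇒+∣i∣≡i (ℤP.i≤i⊔j (+ 0) (⌊x-b⌋ u w))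

    private
      add-diff : ∀ x y → x + (y - x) ≡ y
      add-diff = solve-∀
      swap-sub : ∀ w u B → (w - u) - B ≡ (w - B) - u
      swap-sub = solve-∀

    ≤upper⇒gap<top : ∀ u w t → 1 ℕ.≤ t → t ℕ.≤ upper u w → top u + + t * A < top w
    ≤upper⇒gap<top u w t ht t≤ = <−⇒+< (top u) (+ t * A) (top w) (ℤP.≤∧≢⇒< tA≤D tA≢D)
      where
        t≤⌊x⌋ : + t ≤ ⌊x⌋ u w
        t≤⌊x⌋ = ≤0⊔⇒≤ ht (subst (+ t ≤_) (+upper u w) (+≤+ t≤))
        tA≤D : + t * A ≤ D u w
        tA≤D = ℤP.≤-trans (ℤP.*-monoʳ-≤-nonNeg A t≤⌊x⌋) (proj₁ (⌊x⌋-spec u w))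
        -- equality would make the gap top u + t·a the bead top w
        tA≢D : + t * A ≢ D u w
        tA≢D eq = above-top-not-bead u t ht
                    (subst IsBead (trans (sym (add-diff (top u) (top w))) (cong (λ n → top u + n) (sym eq))) (top-is-bead w))

    gap<top⇒≤upper : ∀ u w t → top u + + t * A < top w → t ℕ.≤ upper u w
    gap<top⇒≤upper u w t below = ℤP.drop‿+≤+ (subst (+ t ≤_) (sym (+upper u w)) (≤⇒≤0⊔ t≤⌊x⌋))
      where
        t<⌊x⌋+1 : + t < ⌊x⌋ u w + + 1
        t<⌊x⌋+1 = ℤP.*-cancelʳ-<-nonNeg A (ℤP.<-trans (+<⇒<− (top u) (+ t * A) (top w) below) (proj₂ (⌊x⌋-spec u w)))
        t≤⌊x⌋ : + t ≤ ⌊x⌋ u w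
        t≤⌊x⌋ = +-cancelʳ-≤ (+ t) (⌊x⌋ u w) (+ 1) (<⇒+1≤ t<⌊x⌋+1)

    lower<⇒window : ∀ u w t → lower u w ℕ.< t → top w - + b < top u + + t * A
    lower<⇒window u w t lower<t = −<⇒<+ (top w - + b) (top u) (+ t * A) (subst (_< + t * A) (swap-sub (top w) (top u) (+ b)) D-b<tA)
      where
        ⌊x-b⌋<t : ⌊x-b⌋ u w < + t
        ⌊x-b⌋<t = 0⊔<⇒< (subst (_< + t) (+lower u w) (+<+ lower<t))
        D-b<tA : D u w - + b < + t * A
        D-b<tA = ℤP.<-≤-trans (proj₂ (⌊x-b⌋-spec u w)) (ℤP.*-monoʳ-≤-nonNeg A (<⇒+1≤ ⌊x-b⌋<t))

    window⇒lower< : ∀ u w t → 1 ℕ.≤ t → top w - + b < top u + + t * A → lower u w ℕ.< t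
    window⇒lower< u w t ht above = ℤP.drop‿+<+ (subst (_< + t) (sym (+lower u w)) (<⇒0⊔< ht ⌊x-b⌋<t))
      where
        D-b<tA : D u w - + b < + t * A
        D-b<tA = subst (_< + t * A) (sym (swap-sub (top w) (top u) (+ b))) (<+⇒−< (top w - + b) (top u) (+ t * A) above)
        ⌊x-b⌋<t : ⌊x-b⌋ u w < + t
        ⌊x-b⌋<t = ℤP.*-cancelʳ-<-nonNeg A (ℤP.≤-<-trans (proj₁ (⌊x-b⌋-spec u w)) D-b<tA)

    lower≤upper : ∀ u w → lower u w ℕ.≤ upper u w
    lower≤upper u w = ℤP.drop‿+≤+ (subst₂ _≤_ (sym (+lower u w)) (sym (+upper u w)) (ℤP.⊔-monoʳ-≤ (+ 0) ⌊x-b⌋≤⌊x⌋))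
      where
        ⌊x-b⌋<⌊x⌋+1 : ⌊x-b⌋ u w < ⌊x⌋ u w + + 1
        ⌊x-b⌋<⌊x⌋+1 = ℤP.*-cancelʳ-<-nonNeg A (ℤP.≤-<-trans (proj₁ (⌊x-b⌋-spec u w))
                        (ℤP.≤-<-trans (ℤP.i≤j⇒i-k≤j (+ b) ℤP.≤-refl) (proj₂ (⌊x⌋-spec u w))))
        ⌊x-b⌋≤⌊x⌋ : ⌊x-b⌋ u w ≤ ⌊x⌋ u w
        ⌊x-b⌋≤⌊x⌋ = +-cancelʳ-≤ (⌊x-b⌋ u w) (⌊x⌋ u w) (+ 1) (<⇒+1≤ ⌊x-b⌋<⌊x⌋+1)

    summand≡window : ∀ u w → + (upper u w ℕ.∸ lower u w)
                   ≡ floor₀ (x u ℚ.- x w) - floor₀ (x u ℚ.- x w ℚ.- (+ b) ℚ./ a)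
    summand≡window u w = trans (pos-∸ (lower≤upper u w)) (cong₂ _-_ (+upper u w) (+lower u w))

open FloorDifferences

module SkewCount where

  open import Data.Nat as ℕ using (ℕ; suc; s≤s; z≤n; _≤?_; _<?_)
  import Data.Nat.Properties as ℕP
  open import Data.Integer as ℤ using (ℤ; +_; _+_; _*_; _-_; -_; _<_; +<+)
  import Data.Integer.Properties as ℤP
  open import Data.Fin using (Fin)
  import Data.Fin.Properties as FinP
  open import Data.List using (List; length; map; filter; cartesianProduct; upTo; applyUpTo)
  open import Data.List.Properties using (length-map; length-applyUpTo)
  open import Data.List.Relation.Unary.Linked using (Linked)
  open import Data.List.Relation.Unary.Unique.Propositional using (Unique)
  import Data.List.Relation.Unary.Unique.Propositional.Properties as Unique
  open import Data.List.Membership.Propositional using (_∈_)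
  import Data.List.Membership.Propositional.Properties as ∈
  open import Data.Product using (_×_; _,_; ∃-syntax; proj₁; proj₂)
  open import Relation.Nullary using (¬_; yes; no; Dec)
  open import Relation.Nullary.Decidable using (_×-dec_; map′)
  open import Relation.Binary.PropositionalEquality
  open import Function.Bundles using (_⇔_; mk⇔; Equivalence)
  open import Defs using (IsCoreOf; IsARow; SkewCell; hook; part; skewSum)

  -- A cell (j , k) is sent to the boundary pair
  -- (bead j , gap k); skew cells correspond exactly to the "skew pairs"
  -- (v , e) with v a top bead, e a gap and v - b < e < v.
  module Count (k0 : ℕ) (c : Fin (suc k0) → ℤ) (p : List ℕ) (decreasing : Linked ℕ._≥_ p)
               (core : IsCoreOf (suc k0) c p) (b : ℕ) where

    open Floors k0 c p decreasing core b public

    a-row? : ∀ j → Dec (IsARow a p j)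
    a-row? j with 1 ≤? j
    ... | yes hj = map′ (top⇒a-row hj) a-row⇒top (FinP.any? (λ i → bead j ℤ.≟ top i))
    ... | no  hj = no (λ row → hj (proj₁ row))

    skew-cell? : ∀ x → Dec (SkewCell a b p x)
    skew-cell? (j , k) = ((1 ≤? j) ×-dec (1 ≤? k) ×-dec (k ≤? part p j)) ×-dec a-row? j ×-dec (hook p (j , k) <? b)

    -- All cells lie in the box [0, λ'_1] × [0, λ_1].
    box : List (ℕ × ℕ)
    box = cartesianProduct (upTo (suc (colLen 1))) (upTo (suc (rowLen 1)))

    skewCells : List (ℕ × ℕ)
    skewCells = filter skew-cell? box

    skewCells-unique : Unique skewCells
    skewCells-unique = Unique.filter⁺ skew-cell? {xs = box}
      (Unique.cartesianProduct⁺ (Unique.upTo⁺ (suc (colLen 1))) (Unique.upTo⁺ (suc (rowLen 1))))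

    ∈skewCells⇔ : ∀ x → (x ∈ skewCells) ⇔ SkewCell a b p x
    ∈skewCells⇔ x = mk⇔ (λ m → proj₂ (∈.∈-filter⁻ skew-cell? {xs = box} m)) (listed x)
      where
        listed : ∀ x → SkewCell a b p x → x ∈ skewCells
        listed (j , k) skew@((hj , hk , k≤λ) , _ , _) =
          ∈.∈-filter⁺ skew-cell?
            (∈.∈-cartesianProduct⁺
              (∈.∈-upTo⁺ (s≤s (cell⇒conj hj (s≤s z≤n) (ℕP.≤-trans hk k≤λ))))
              (∈.∈-upTo⁺ (s≤s (conj⇒cell (s≤s z≤n) hk (ℕP.≤-trans hj (cell⇒conj hj hk k≤λ))))))
            skew

    boundaryPair : ℕ × ℕ → ℤ × ℤ
    boundaryPair (j , k) = bead j , gap k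

    boundaryPairs : List (ℤ × ℤ)
    boundaryPairs = map boundaryPair skewCells

    boundaryPairs-unique : Unique boundaryPairs
    boundaryPairs-unique = unique-map-on boundaryPair skewCells-unique injective
      where
        injective : ∀ {x y} → x ∈ skewCells → y ∈ skewCells → boundaryPair x ≡ boundaryPair y → x ≡ y
        injective {j , k} {j' , k'} m m' eq =
          let (hj , hk , _) , _ = Equivalence.to (∈skewCells⇔ _) m
              (hj' , hk' , _) , _ = Equivalence.to (∈skewCells⇔ _) m'
          in cong₂ _,_ (bead-injective hj hj' (cong proj₁ eq)) (gap-injective hk hk' (cong proj₂ eq))

    SkewPair : ℤ × ℤ → Set
    SkewPair (v , e) = IsTop v × ¬ IsBead e × v - + b < e × e < v

    private
      hook<b⇒window : ∀ v e → v - e < + b → v - + b < e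
      hook<b⇒window v e h = <+⇒−< v (+ b) e (subst (v <_) (ℤP.+-comm e (+ b)) (−<⇒<+ v e (+ b) h))
      window⇒hook<b : ∀ v e → v - + b < e → v - e < + b
      window⇒hook<b v e h = <+⇒−< v e (+ b) (subst (v <_) (ℤP.+-comm (+ b) e) (−<⇒<+ v (+ b) e h))

    skewCell⇒skewPair : ∀ {x} → SkewCell a b p x → SkewPair (boundaryPair x)
    skewCell⇒skewPair {j , k} ((hj , hk , k≤λ) , row , hook<b) =
      a-row⇒top row , gap-not-bead hk
      , hook<b⇒window (bead j) (gap k) (subst (_< + b) (hook≡bead-gap hj hk k≤λ) (+<+ hook<b))
      , cell⇒gap<bead hj hk k≤λ

    boundaryPair⇒skewPair : ∀ {z} → z ∈ boundaryPairs → SkewPair z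
    boundaryPair⇒skewPair m =
      let x , x∈ , z≡ = ∈.∈-map⁻ boundaryPair m
      in subst SkewPair (sym z≡) (skewCell⇒skewPair (Equivalence.to (∈skewCells⇔ x) x∈))

    skewPair⇒boundaryPair : ∀ {z} → SkewPair z → z ∈ boundaryPairs
    skewPair⇒boundaryPair {v , e} ((i , v≡top) , ¬bead , window , e<v) =
      let j , hj , bead≡ = top-is-bead i
          k , hk , gap≡ = non-bead⇒gap ¬bead
          bead≡v : bead j ≡ v
          bead≡v = trans bead≡ (sym v≡top)
          k≤λ : k ℕ.≤ rowLen j
          k≤λ = gap<bead⇒cell hj hk (subst₂ _<_ (sym gap≡) (sym bead≡v) e<v)
          hook<b : hook p (j , k) ℕ.< b
          hook<b = ℤP.drop‿+<+ (subst (_< + b) (sym (hook≡bead-gap hj hk k≤λ))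
                     (window⇒hook<b (bead j) (gap k) (subst₂ (λ v e → v - + b < e) (sym bead≡v) (sym gap≡) window)))
          skew : SkewCell a b p (j , k)
          skew = (hj , hk , k≤λ) , top⇒a-row hj (i , bead≡) , hook<b
      in subst (_∈ boundaryPairs) (cong₂ _,_ bead≡v gap≡) (∈.∈-map⁺ boundaryPair (Equivalence.from (∈skewCells⇔ _) skew))

    windowPair : Fin a → Fin a → ℕ → ℤ × ℤ
    windowPair u w i = top w , top u + + (suc (lower u w) ℕ.+ i) * A

    window : Fin a → Fin a → List (ℤ × ℤ)
    window u w = applyUpTo (windowPair u w) (upper u w ℕ.∸ lower u w)

    windows : List (ℤ × ℤ)
    windows = concatFin (λ u → concatFin (window u))

    InWindow : ℤ × ℤ → Set
    InWindow z = ∃[ u ] ∃[ w ] ∃[ t ] ((lower u w ℕ.< t × t ℕ.≤ upper u w) × z ≡ (top w , top u + + t * A))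

    top-injective : ∀ {w w'} → top w ≡ top w' → w ≡ w'
    top-injective {w} {w'} eq = proj₂ (position-injective (- c w) (- c w') w w' eq)

    above-top-runner : ∀ {u u' t t'} → top u + + t * A ≡ top u' + + t' * A → u ≡ u'
    above-top-runner {u} {u'} {t} {t'} eq = proj₂ (position-injective (- c u + + t) (- c u' + + t') u u'
      (trans (sym (position-shift (- c u) (+ t) u)) (trans eq (position-shift (- c u') (+ t') u'))))

    above-top-height : ∀ {u t t'} → top u + + t * A ≡ top u + + t' * A → t ≡ t'
    above-top-height {u} {t} {t'} eq = ℤP.+-injective (ℤP.*-cancelʳ-≡ (+ t) (+ t') A
      (+-cancelʳ-≡ (+ t * A) (+ t' * A) (top u)
        (trans (ℤP.+-comm (+ t * A) (top u)) (trans eq (ℤP.+-comm (top u) (+ t' * A))))))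

    ∈window⇒InWindow : ∀ {u w z} → z ∈ window u w → InWindow z
    ∈window⇒InWindow {u} {w} m =
      let i , i<n , z≡ = ∈.∈-applyUpTo⁻ (windowPair u w) m
          t≤upper : suc (lower u w) ℕ.+ i ℕ.≤ upper u w
          t≤upper = subst (suc (lower u w) ℕ.+ i ℕ.≤_) (ℕP.m+[n∸m]≡n (lower≤upper u w)) (ℕP.+-monoʳ-< (lower u w) i<n)
      in u , w , suc (lower u w) ℕ.+ i , (s≤s (ℕP.m≤m+n (lower u w) i) , t≤upper) , z≡

    InWindow⇒∈windows : ∀ {z} → InWindow z → z ∈ windows
    InWindow⇒∈windows (u , w , t , (lower<t , t≤upper) , refl) =
      ∈-concatFin⁺ (λ u → concatFin (window u)) u (∈-concatFin⁺ (window u) w (subst (_∈ window u w) (cong (λ s → top w , top u + + s * A) t≡)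
        (∈.∈-applyUpTo⁺ (windowPair u w) i<n)))
      where
        i = t ℕ.∸ suc (lower u w)
        t≡ : suc (lower u w) ℕ.+ i ≡ t
        t≡ = ℕP.m+[n∸m]≡n lower<t
        i<n : i ℕ.< upper u w ℕ.∸ lower u w
        i<n = ℕP.m+n≤o⇒m≤o∸n (suc i)
                (subst (ℕ._≤ upper u w) (trans (sym t≡) (cong suc (ℕP.+-comm (lower u w) i))) t≤upper)

    windows-unique : Unique windows
    windows-unique = unique-concatFin (λ u → concatFin (window u))
                       (λ u → unique-concatFin (window u) (window-unique u) (λ w w' m m' → same-top m m'))
                       (λ u u' m m' → same-runner m m')
      where
        window-unique : ∀ u w → Unique (window u w)
        window-unique u w = Unique.applyUpTo⁺₁ (windowPair u w) (upper u w ℕ.∸ lower u w)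
          (λ {i} {j} i<j _ eq → ℕP.<-irrefl (ℕP.+-cancelˡ-≡ (suc (lower u w)) i j (above-top-height {u} (cong proj₂ eq))) i<j)
        same-top : ∀ {u w w' z} → z ∈ window u w → z ∈ window u w' → w ≡ w'
        same-top {u} {w} {w'} m m' =
          let _ , _ , _ , _ , eq = ∈window⇒InWindow m
              _ , _ , _ , _ , eq' = ∈window⇒InWindow m'
          in top-injective {w} {w'} (trans (sym (cong proj₁ eq)) (cong proj₁ eq'))
        same-runner : ∀ {u u' z} → z ∈ concatFin (window u) → z ∈ concatFin (window u') → u ≡ u'
        same-runner {u} {u'} m m' =
          let w , mw = ∈-concatFin⁻ (window u) m
              w' , mw' = ∈-concatFin⁻ (window u') m'
              _ , _ , t , _ , eq = ∈window⇒InWindow mw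
              _ , _ , t' , _ , eq' = ∈window⇒InWindow mw'
          in above-top-runner {u} {u'} {t} {t'} (trans (sym (cong proj₂ eq)) (cong proj₂ eq'))

    InWindow⇒skewPair : ∀ {z} → InWindow z → SkewPair z
    InWindow⇒skewPair (u , w , t , (lower<t , t≤upper) , refl) =
      (w , refl) , above-top-not-bead u t ht , lower<⇒window u w t lower<t , ≤upper⇒gap<top u w t ht t≤upper
      where ht = ℕP.≤-trans (s≤s z≤n) lower<t

    skewPair⇒InWindow : ∀ {z} → SkewPair z → InWindow z
    skewPair⇒InWindow {_ , e} ((w , refl) , ¬bead , above , below) =
      let u , t , ht , e≡ = non-bead⇒above-top ¬bead
          above′ = subst (top w - + b <_) e≡ above
          below′ = subst (_< top w) e≡ below
      in u , w , t , (window⇒lower< u w t ht above′ , gap<top⇒≤upper u w t below′) , cong (top w ,_) e≡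

    length-windows : + length windows ≡ skewSum a b c
    length-windows =
      trans (length-concatFin (λ u → concatFin (window u))) (sumℤ-cong λ u →
        trans (length-concatFin (window u)) (sumℤ-cong λ w →
          trans (cong +_ (length-applyUpTo (windowPair u w) (upper u w ℕ.∸ lower u w))) (summand≡window u w)))

    length-skewCells : length skewCells ≡ length windows
    length-skewCells = trans (sym (length-map boundaryPair skewCells))
      (unique-length boundaryPairs-unique windows-unique λ z →
        mk⇔ (λ m → InWindow⇒∈windows (skewPair⇒InWindow (boundaryPair⇒skewPair m)))
            (λ m → skewPair⇒boundaryPair (InWindow⇒skewPair (∈windows⇒InWindow m))))
      where
        ∈windows⇒InWindow : ∀ {z} → z ∈ windows → InWindow z
        ∈windows⇒InWindow m =
          let u , mu = ∈-concatFin⁻ (λ u → concatFin (window u)) m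
              w , mw = ∈-concatFin⁻ (window u) mu
          in ∈window⇒InWindow mw

open SkewCount

open import Defs
open import Data.Nat using (ℕ; NonZero; _<_; zero; suc)
open import Data.Nat.Coprimality using (Coprime)
open import Data.Integer using (ℤ; +_)
open import Data.Fin using (Fin)
open import Data.List using (List; length)
open import Data.List.Relation.Unary.Unique.Propositional using (Unique)
open import Data.List.Membership.Propositional using (_∈_)
open import Data.Product using (Σ; ∃-syntax; _×_; _,_)
open import Function.Bundles using (_⇔_)
open import Relation.Binary.PropositionalEquality using (_≡_; cong; trans)

mainTheorem8 : (a b : ℕ) .{{_ : NonZero a}} → a < b → Coprime a b
    → (c : Fin a → ℤ) → sumℤ c ≡ + 0
    → (p : List ℕ) → IsPartition p → IsCoreOf a c p → IsCore₂ a b p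
    → ∃[ L ] (Unique L × (∀ x → (x ∈ L) ⇔ SkewCell a b p x)
              × + length L ≡ skewSum a b c)
mainTheorem8 zero    b ⦃ () ⦄ _ _ c _ p _ _ _
mainTheorem8 (suc k0) b _ _ c _ p (decreasing , _) core _ =
  skewCells , skewCells-unique , ∈skewCells⇔ , trans (cong +_ length-skewCells) length-windows
  where open Count k0 c p decreasing core b
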